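{- Let $n\ge3$ be an integer and let $f$ be a $\gamma_{tr3}(P_3\square P_n)$-function such that the number of vertices $v$ with $f(v)=\emptyset$ is minimum among all $\gamma_{tr3}(P_3\square P_n)$-functions. Then $|f((i,0))|=1$ for each $i\in\{0,1,2\}$ and $|f((0,j))|=1$ for each $j\in\{1,2,\dots,n-1\}$.
   Context: $P_m$ denotes the directed path with vertex set $\{0,1,\dots,m-1\}$ and arcs $(i,i+1)$ for $0\le i\le m-2$. The Cartesian product $D_1\square D_2$ has vertex set $V(D_1)\times V(D_2)$, with an arc from $(x_1,y_1)$ to $(x_2,y_2)$ iff either $(x_1,x_2)$ is an arc of $D_1$ and $y_1=y_2$, or $x_1=x_2$ and $(y_1,y_2)$ is an arc of $D_2$; so vertices of $P_3\square P_n$ are $(i,j)$ with $i\in\{0,1,2\}$, $j\in\{0,\dots,n-1\}$. For a digraph $D$ and positive integer $k$, a $k$RDF is a function $f:V(D)\to\mathcal{P}(\{1,\dots,k\})$ such that every $v$ with $f(v)=\emptyset$ satisfies $\bigcup_{u\in N^-(v)}f(u)=\{1,\dots,k\}$ ($N^-(v)$ the in-neighbors of $v$); its weight is $\sum_v|f(v)|$. A T$k$RDF is a $k$RDF $f$ such that the subdigraph induced by $\{v:f(v)\neq\emptyset\}$ has no isolated vertex; $\gamma_{trk}(D)$ is the minimum weight of a T$k$RDF, and a T$k$RDF of that weight is a $\gamma_{trk}(D)$-function. -}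

module Defs where

open import Data.Nat using (ℕ; zero; suc; _+_; _≤_)
open import Data.Fin using (Fin; toℕ)
import Data.Fin as F
open import Data.Fin.Subset using (Subset; ⊥; ∣_∣; _∈_)
open import Data.Product using (_×_; _,_; ∃; Σ)
open import Data.Sum using (_⊎_)
open import Data.Bool using (Bool; true; false)
import Data.Bool as B
open import Data.Vec.Properties using (≡-dec)
open import Relation.Binary.PropositionalEquality using (_≡_)
open import Relation.Nullary using (¬_; yes; no)

sumFin : (n : ℕ) → (Fin n → ℕ) → ℕ
sumFin zero    g = 0
sumFin (suc n) g = g F.zero + sumFin n (λ i → g (F.suc i))

PArc : {m : ℕ} → Fin m → Fin m → Set
PArc i j = toℕ j ≡ suc (toℕ i)

V : ℕ → ℕ → Set
V m n = Fin m × Fin n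

Arc : {m n : ℕ} → V m n → V m n → Set
Arc (x₁ , y₁) (x₂ , y₂) = (PArc x₁ x₂ × y₁ ≡ y₂) ⊎ (x₁ ≡ x₂ × PArc y₁ y₂)

-- Labelings f : V → P({1,…,k}); colours 1..k are represented by Fin k.
Labeling : ℕ → ℕ → ℕ → Set
Labeling k m n = V m n → Subset k

IsKRDF : (k m n : ℕ) → Labeling k m n → Set
IsKRDF k m n f = ∀ (v : V m n) → f v ≡ ⊥ →
  ∀ (c : Fin k) → ∃ λ (u : V m n) → Arc u v × c ∈ f u

IsTKRDF : (k m n : ℕ) → Labeling k m n → Set
IsTKRDF k m n f = IsKRDF k m n f ×
  (∀ (v : V m n) → ¬ (f v ≡ ⊥) →
     ∃ λ (u : V m n) → ¬ (f u ≡ ⊥) × (Arc u v ⊎ Arc v u))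

weight : (k m n : ℕ) → Labeling k m n → ℕ
weight k m n f = sumFin m (λ i → sumFin n (λ j → ∣ f (i , j) ∣))

isEmptyB : {k : ℕ} → Subset k → Bool
isEmptyB p with ≡-dec B._≟_ p ⊥
... | yes _ = true
... | no  _ = false

numEmpty : (k m n : ℕ) → Labeling k m n → ℕ
numEmpty k m n f = sumFin m (λ i → sumFin n (λ j →
  B.if isEmptyB (f (i , j)) then 1 else 0))

IsGammaTRKFunction : (k m n : ℕ) → Labeling k m n → Set
IsGammaTRKFunction k m n f = IsTKRDF k m n f ×
  (∀ (g : Labeling k m n) → IsTKRDF k m n g → weight k m n f ≤ weight k m n g)

-- Suppose a vertex v had |f(v)| ≥ 2.  Give v a single colour and give one colour to each empty
-- out-neighbour of v.  The result is again a total rainbow dominating function; if e is the number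
-- of empty out-neighbours, its weight is w(f) − |f(v)| + 1 + e and it has e fewer empty vertices.
-- Minimality of the weight, and then of the number of empty vertices, forces |f(v)| ≤ e.
-- A vertex of the first row or column has at most two out-neighbours, one of which has v as its
-- only in-neighbour.  If that one is empty, f(v) holds all k ≥ 3 colours while e ≤ 2; otherwise
-- e ≤ 1 < |f(v)|.  Hence |f(v)| ≤ 1.  Finally these vertices are non-empty: the corner has no
-- in-neighbour, and every other one has a single in-neighbour carrying fewer than k colours.
module Submission where

open import Defs
open import Data.Nat using (ℕ; zero; suc; _+_; _≤_; _<_; z≤n; s≤s)
open import Data.Nat.Properties
  using ( _≤?_; _<?_; ≤-refl; ≤-reflexive; ≤-trans; ≤-antisym; <-≤-trans; ≤-<-trans
        ; ≰⇒>; <⇒≢; <⇒≱; n≤0⇒n≡0; 1+n≢n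
        ; m≤m+n; m≤n+m; +-mono-≤; +-monoˡ-≤; +-cancelˡ-≤; +-cancelʳ-≡
        ; +-assoc; +-comm; +-identityʳ; suc-injective; +-commutativeSemigroup; module ≤-Reasoning )
  renaming (_≟_ to _≟ℕ_)
open import Algebra.Properties.CommutativeSemigroup +-commutativeSemigroup using (interchange)
open import Data.Fin using (Fin; zero; suc; toℕ; fromℕ<; inject₁)
open import Data.Fin.Properties using (toℕ-injective; toℕ-fromℕ<; toℕ<n; toℕ-inject₁)
  renaming (_≟_ to _≟F_; suc-injective to Fin-suc-injective)
open import Data.Fin.Subset using (Subset; ⊥; ⁅_⁆; ∣_∣; _∈_)
open import Data.Fin.Subset.Properties
  using ( ∉⊥; x∈⁅x⁆; x∈⁅y⁆⇒x≡y; ∣⊥∣≡0; ∣⁅x⁆∣≡1; ∣⊤∣≡n; ⊆⊤; ⊆-antisym; p⊆q⇒∣p∣≤∣q∣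
        ; nonempty?; Empty-unique )
open import Data.Product using (_×_; _,_; ∃; proj₁; proj₂)
open import Data.Product.Properties using (≡-dec)
open import Data.Sum using (_⊎_; inj₁; inj₂; [_,_]′; swap)
open import Data.Bool using (if_then_else_)
import Data.Bool as B
open import Data.List using (List; []; _∷_; length)
open import Data.List.Membership.Propositional using () renaming (_∈_ to _∈ₗ_)
open import Data.List.Relation.Unary.Any using (here; there)
import Data.Vec.Properties as Vec
open import Function using (_∘_)
open import Level using (0ℓ)
open import Relation.Binary.PropositionalEquality
  using (_≡_; _≢_; refl; sym; trans; cong; cong₂; subst; module ≡-Reasoning)
open import Relation.Nullary using (¬_; Dec; yes; no; contradiction)
open import Relation.Nullary.Decidable using (isYes; _×-dec_; _⊎-dec_)
open import Relation.Unary using (Pred; Decidable)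

sumFin-cong : ∀ n {g h : Fin n → ℕ} → (∀ j → g j ≡ h j) → sumFin n g ≡ sumFin n h
sumFin-cong zero    g≗h = refl
sumFin-cong (suc n) g≗h = cong₂ _+_ (g≗h zero) (sumFin-cong n (g≗h ∘ suc))

sumFin-distrib-+ : ∀ n (g h : Fin n → ℕ) →
                   sumFin n (λ j → g j + h j) ≡ sumFin n g + sumFin n h
sumFin-distrib-+ zero    g h = refl
sumFin-distrib-+ (suc n) g h =
  trans (cong (g zero + h zero +_) (sumFin-distrib-+ n (g ∘ suc) (h ∘ suc)))
        (interchange (g zero) (h zero) (sumFin n (g ∘ suc)) (sumFin n (h ∘ suc)))

sumFin-mono-≤ : ∀ n {g h : Fin n → ℕ} → (∀ j → g j ≤ h j) → sumFin n g ≤ sumFin n h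
sumFin-mono-≤ zero    g≤h = z≤n
sumFin-mono-≤ (suc n) g≤h = +-mono-≤ (g≤h zero) (sumFin-mono-≤ n (g≤h ∘ suc))

sumFin-zero : ∀ n {g : Fin n → ℕ} → (∀ j → g j ≡ 0) → sumFin n g ≡ 0
sumFin-zero zero    g≗0 = refl
sumFin-zero (suc n) g≗0 = cong₂ _+_ (g≗0 zero) (sumFin-zero n (g≗0 ∘ suc))

sumFin-single : ∀ {n} (q : Fin n) {g : Fin n → ℕ} → (∀ j → j ≢ q → g j ≡ 0) → sumFin n g ≡ g q
sumFin-single {suc n} zero    {g} g≗0 =
  trans (cong (g zero +_) (sumFin-zero n (λ j → g≗0 (suc j) λ ()))) (+-identityʳ (g zero))
sumFin-single {suc n} (suc q) {g} g≗0 =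
  cong₂ _+_ (g≗0 zero λ ()) (sumFin-single q (λ j j≢q → g≗0 (suc j) (j≢q ∘ Fin-suc-injective)))

module _ {m n : ℕ} where

  gridSum : (V m n → ℕ) → ℕ
  gridSum F = sumFin m (λ i → sumFin n (λ j → F (i , j)))

  gridSum-cong : {F G : V m n → ℕ} → (∀ u → F u ≡ G u) → gridSum F ≡ gridSum G
  gridSum-cong F≗G = sumFin-cong m (λ i → sumFin-cong n (λ j → F≗G (i , j)))

  gridSum-distrib-+ : (F G : V m n → ℕ) → gridSum (λ u → F u + G u) ≡ gridSum F + gridSum G
  gridSum-distrib-+ F G =
    trans (sumFin-cong m (λ i → sumFin-distrib-+ n _ _)) (sumFin-distrib-+ m _ _)

  gridSum-mono-≤ : {F G : V m n → ℕ} → (∀ u → F u ≤ G u) → gridSum F ≤ gridSum G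
  gridSum-mono-≤ F≤G = sumFin-mono-≤ m (λ i → sumFin-mono-≤ n (λ j → F≤G (i , j)))

  gridSum-single : (p : V m n) {F : V m n → ℕ} → (∀ u → u ≢ p → F u ≡ 0) → gridSum F ≡ F p
  gridSum-single (p₁ , p₂) F≗0 =
    trans (sumFin-single p₁ (λ i i≢p₁ → sumFin-zero n (λ j → F≗0 (i , j) (i≢p₁ ∘ cong proj₁))))
          (sumFin-single p₂ (λ j j≢p₂ → F≗0 (p₁ , j) (j≢p₂ ∘ cong proj₂)))

  _≟V_ : (u w : V m n) → Dec (u ≡ w)
  _≟V_ = ≡-dec _≟F_ _≟F_

  pointMass : V m n → ℕ → V m n → ℕ
  pointMass p a u = if isYes (u ≟V p) then a else 0

  pointMass-self : ∀ p a → pointMass p a p ≡ a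
  pointMass-self p a with p ≟V p
  ... | yes _   = refl
  ... | no  p≢p = contradiction refl p≢p

  gridSum-pointMass : ∀ p a → gridSum (pointMass p a) ≡ a
  gridSum-pointMass p a = trans (gridSum-single p vanishes) (pointMass-self p a)
    where
    vanishes : ∀ u → u ≢ p → pointMass p a u ≡ 0
    vanishes u u≢p with u ≟V p
    ... | yes u≡p = contradiction u≡p u≢p
    ... | no  _   = refl

  count : {P : Pred (V m n) 0ℓ} → Decidable P → ℕ
  count P? = gridSum (λ u → if isYes (P? u) then 1 else 0)

  multiplicity : List (V m n) → V m n → ℕ
  multiplicity []       u = 0
  multiplicity (x ∷ xs) u = pointMass x 1 u + multiplicity xs u

  gridSum-multiplicity : ∀ xs → gridSum (multiplicity xs) ≡ length xs
  gridSum-multiplicity []       = sumFin-zero m (λ i → sumFin-zero n (λ j → refl))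
  gridSum-multiplicity (x ∷ xs) =
    trans (gridSum-distrib-+ _ _) (cong₂ _+_ (gridSum-pointMass x 1) (gridSum-multiplicity xs))

  ∈⇒1≤multiplicity : ∀ {u xs} → u ∈ₗ xs → 1 ≤ multiplicity xs u
  ∈⇒1≤multiplicity {u} {xs = _ ∷ xs} (here refl) =
    ≤-trans (≤-reflexive (sym (pointMass-self u 1))) (m≤m+n _ (multiplicity xs u))
  ∈⇒1≤multiplicity {u} {xs = x ∷ _} (there u∈xs) =
    ≤-trans (∈⇒1≤multiplicity u∈xs) (m≤n+m _ (pointMass x 1 u))

  count≤length : {P : Pred (V m n) 0ℓ} (P? : Decidable P) (xs : List (V m n)) →
                 (∀ u → P u → u ∈ₗ xs) → count P? ≤ length xs
  count≤length P? xs P⊆xs =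
    ≤-trans (gridSum-mono-≤ indicator≤multiplicity) (≤-reflexive (gridSum-multiplicity xs))
    where
    indicator≤multiplicity : ∀ u → (if isYes (P? u) then 1 else 0) ≤ multiplicity xs u
    indicator≤multiplicity u with P? u
    ... | yes Pu = ∈⇒1≤multiplicity (P⊆xs u Pu)
    ... | no  _  = z≤n

wt : ∀ {k m n} → Labeling k m n → ℕ
wt {k} {m} {n} = weight k m n

#∅ : ∀ {k m n} → Labeling k m n → ℕ
#∅ {k} {m} {n} = numEmpty k m n

emptyIndicator : ∀ {k} → Subset k → ℕ
emptyIndicator p = B.if isEmptyB p then 1 else 0

emptyIndicator-⊥ : ∀ {k} → emptyIndicator (⊥ {k}) ≡ 1
emptyIndicator-⊥ {k} with Vec.≡-dec B._≟_ (⊥ {k}) ⊥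
... | yes _   = refl
... | no  ⊥≢⊥ = contradiction refl ⊥≢⊥

emptyIndicator-≢⊥ : ∀ {k} {p : Subset k} → p ≢ ⊥ → emptyIndicator p ≡ 0
emptyIndicator-≢⊥ {p = p} p≢⊥ with Vec.≡-dec B._≟_ p ⊥
... | yes p≡⊥ = contradiction p≡⊥ p≢⊥
... | no  _   = refl

⁅x⁆≢⊥ : ∀ {k} (x : Fin k) → ⁅ x ⁆ ≢ ⊥
⁅x⁆≢⊥ x ⁅x⁆≡⊥ = ∉⊥ (subst (x ∈_) ⁅x⁆≡⊥ (x∈⁅x⁆ x))

1≤∣p∣⇒p≢⊥ : ∀ {k} {p : Subset k} → 1 ≤ ∣ p ∣ → p ≢ ⊥
1≤∣p∣⇒p≢⊥ {k} 1≤∣p∣ refl = contradiction (≤-trans 1≤∣p∣ (≤-reflexive (∣⊥∣≡0 k))) λ ()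

p≢⊥⇒1≤∣p∣ : ∀ {k} {p : Subset k} → p ≢ ⊥ → 1 ≤ ∣ p ∣
p≢⊥⇒1≤∣p∣ {p = p} p≢⊥ with nonempty? p
... | yes (x , x∈p) = ≤-trans (≤-reflexive (sym (∣⁅x⁆∣≡1 x))) (p⊆q⇒∣p∣≤∣q∣ ⁅x⁆⊆p)
  where
  ⁅x⁆⊆p : ∀ {y} → y ∈ ⁅ x ⁆ → y ∈ p
  ⁅x⁆⊆p y∈⁅x⁆ = subst (_∈ p) (sym (x∈⁅y⁆⇒x≡y x y∈⁅x⁆)) x∈p
... | no  empty = contradiction (Empty-unique empty) p≢⊥

module _ {m : ℕ} where

  PArc? : (i j : Fin m) → Dec (PArc i j)
  PArc? i j = toℕ j ≟ℕ suc (toℕ i)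

  PArc-irrefl : {i : Fin m} → ¬ PArc i i
  PArc-irrefl i→i = 1+n≢n (sym i→i)

  PArc-injectiveˡ : {i j x : Fin m} → PArc i x → PArc j x → i ≡ j
  PArc-injectiveˡ i→x j→x = toℕ-injective (suc-injective (trans (sym i→x) j→x))

  -- On the last vertex of P_m, which has no successor, next is the identity.
  next : Fin m → Fin m
  next i with suc (toℕ i) <? m
  ... | yes i+1<m = fromℕ< i+1<m
  ... | no  _     = i

  PArc⇒≡next : {i j : Fin m} → PArc i j → j ≡ next i
  PArc⇒≡next {i} {j} i→j with suc (toℕ i) <? m
  ... | yes i+1<m = toℕ-injective (trans i→j (sym (toℕ-fromℕ< i+1<m)))
  ... | no  i+1≮m = contradiction (subst (_< m) i→j (toℕ<n j)) i+1≮m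

PArc-inject₁ : ∀ {m} (j : Fin m) → PArc (inject₁ j) (suc j)
PArc-inject₁ j = cong suc (sym (toℕ-inject₁ j))

module _ {m n : ℕ} where

  Arc? : (u w : V m n) → Dec (Arc u w)
  Arc? (x₁ , y₁) (x₂ , y₂) = (PArc? x₁ x₂ ×-dec y₁ ≟F y₂) ⊎-dec (x₁ ≟F x₂ ×-dec PArc? y₁ y₂)

  Arc-irrefl : {u : V m n} → ¬ Arc u u
  Arc-irrefl (inj₁ (x→x , _)) = PArc-irrefl x→x
  Arc-irrefl (inj₂ (_ , y→y)) = PArc-irrefl y→y

  out-neighbour-next : ∀ {i j w} → Arc {m} {n} (i , j) w → w ≡ (next i , j) ⊎ w ≡ (i , next j)
  out-neighbour-next (inj₁ (i→x , refl)) = inj₁ (cong (_, _) (PArc⇒≡next i→x))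
  out-neighbour-next (inj₂ (refl , j→y)) = inj₂ (cong (_ ,_) (PArc⇒≡next j→y))

OnFirstRowOrColumn : ∀ {m n} → V m n → Set
OnFirstRowOrColumn (i , j) = toℕ i ≡ 0 ⊎ toℕ j ≡ 0

Arc-into-row₀ : ∀ {m n z₁ z₂} {y : Fin n} →
                Arc {suc m} (z₁ , z₂) (zero , y) → z₁ ≡ zero × PArc z₂ y
Arc-into-row₀ (inj₁ (() , _))
Arc-into-row₀ (inj₂ (refl , z₂→y)) = refl , z₂→y

Arc-into-column₀ : ∀ {m n z₁ z₂} {x : Fin m} →
                   Arc {m} {suc n} (z₁ , z₂) (x , zero) → PArc z₁ x × z₂ ≡ zero
Arc-into-column₀ (inj₁ (z₁→x , refl)) = z₁→x , refl
Arc-into-column₀ (inj₂ (_ , ()))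

¬Arc-into-origin : ∀ {m n} (z : V (suc m) (suc n)) → ¬ Arc z (zero , zero)
¬Arc-into-origin (z₁ , z₂) z→0 = contradiction (proj₂ (Arc-into-row₀ z→0)) λ ()

row₀-in-neighbour-unique : ∀ {m n j y} → Arc {suc m} {n} (zero , j) (zero , y) →
                           ∀ (z : V (suc m) n) → Arc z (zero , y) → z ≡ (zero , j)
row₀-in-neighbour-unique j→y (z₁ , z₂) z→y with Arc-into-row₀ z→y
... | refl , z₂→y = cong (zero ,_) (PArc-injectiveˡ z₂→y (proj₂ (Arc-into-row₀ j→y)))

column₀-in-neighbour-unique : ∀ {m n i x} → Arc {m} {suc n} (i , zero) (x , zero) →
                              ∀ (z : V m (suc n)) → Arc z (x , zero) → z ≡ (i , zero)
column₀-in-neighbour-unique i→x (z₁ , z₂) z→x with Arc-into-column₀ z→x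
... | z₁→x , refl = cong (_, zero) (PArc-injectiveˡ z₁→x (proj₁ (Arc-into-column₀ i→x)))

module _ {k m n : ℕ} {f : Labeling k m n} (rdf : IsKRDF k m n f) where

  sole-in-neighbour-saturated : ∀ {u w} → f w ≡ ⊥ → (∀ z → Arc z w → z ≡ u) → ∣ f u ∣ ≡ k
  sole-in-neighbour-saturated {u} {w} fw≡⊥ only-u =
    trans (cong ∣_∣ (⊆-antisym ⊆⊤ (λ {c} _ → c∈fu c))) (∣⊤∣≡n k)
    where
    c∈fu : ∀ c → c ∈ f u
    c∈fu c with rdf w fw≡⊥ c
    ... | z , z→w , c∈fz = subst (λ z → c ∈ f z) (only-u z z→w) c∈fz

  unsaturated-sole-in-neighbour⇒nonempty : ∀ {u w} → ∣ f u ∣ < k →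
                                           (∀ z → Arc z w → z ≡ u) → f w ≢ ⊥
  unsaturated-sole-in-neighbour⇒nonempty ∣fu∣<k only-u fw≡⊥ =
    <⇒≢ ∣fu∣<k (sole-in-neighbour-saturated fw≡⊥ only-u)

module _ {k m n : ℕ} {f : Labeling (suc k) m n} (rdf : IsKRDF (suc k) m n f) where

  source-nonempty : ∀ {w} → (∀ z → ¬ Arc z w) → f w ≢ ⊥
  source-nonempty {w} no-in fw≡⊥ with rdf w fw≡⊥ zero
  ... | z , z→w , _ = no-in z z→w

module Redistribution {k m n : ℕ} (f : Labeling (suc k) m n) (v : V m n) where

  c₀ : Fin (suc k)
  c₀ = zero

  EmptySuccessor : Pred (V m n) 0ℓ
  EmptySuccessor u = Arc v u × f u ≡ ⊥

  emptySuccessor? : Decidable EmptySuccessor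
  emptySuccessor? u = Arc? v u ×-dec Vec.≡-dec B._≟_ (f u) ⊥

  #emptySuccessors : ℕ
  #emptySuccessors = count emptySuccessor?

  redistribute : Labeling (suc k) m n
  redistribute u with u ≟V v | emptySuccessor? u
  ... | yes _ | _     = ⁅ c₀ ⁆
  ... | no  _ | yes _ = ⁅ c₀ ⁆
  ... | no  _ | no  _ = f u

  redistribute-nonempty : ∀ {u} → f u ≢ ⊥ → redistribute u ≢ ⊥
  redistribute-nonempty {u} fu≢⊥ with u ≟V v | emptySuccessor? u
  ... | yes _ | _     = ⁅x⁆≢⊥ c₀
  ... | no  _ | yes _ = ⁅x⁆≢⊥ c₀
  ... | no  _ | no  _ = fu≢⊥

  redistribute-⊥ : ∀ {u} → redistribute u ≡ ⊥ → f u ≡ ⊥ × ¬ Arc v u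
  redistribute-⊥ {u} gu≡⊥ with u ≟V v | emptySuccessor? u
  ... | yes _ | _     = contradiction gu≡⊥ (⁅x⁆≢⊥ c₀)
  ... | no  _ | yes _ = contradiction gu≡⊥ (⁅x⁆≢⊥ c₀)
  ... | no  _ | no ¬E = gu≡⊥ , λ v→u → ¬E (v→u , gu≡⊥)

  redistribute-unchanged : ∀ {u} → u ≢ v → f u ≢ ⊥ → redistribute u ≡ f u
  redistribute-unchanged {u} u≢v fu≢⊥ with u ≟V v | emptySuccessor? u
  ... | yes u≡v | _              = contradiction u≡v u≢v
  ... | no  _   | yes (_ , fu≡⊥) = contradiction fu≡⊥ fu≢⊥
  ... | no  _   | no  _          = refl

  redistribute-isTKRDF : IsTKRDF (suc k) m n f → f v ≢ ⊥ → IsTKRDF (suc k) m n redistribute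
  redistribute-isTKRDF (rdf , total) fv≢⊥ = rdf′ , total′
    where
    rdf′ : IsKRDF (suc k) m n redistribute
    rdf′ u gu≡⊥ c with redistribute-⊥ gu≡⊥
    ... | fu≡⊥ , ¬v→u with rdf u fu≡⊥ c
    ...   | z , z→u , c∈fz = z , z→u , subst (c ∈_) (sym (redistribute-unchanged z≢v fz≢⊥)) c∈fz
      where
      z≢v : z ≢ v
      z≢v refl = ¬v→u z→u
      fz≢⊥ : f z ≢ ⊥
      fz≢⊥ fz≡⊥ = ∉⊥ (subst (c ∈_) fz≡⊥ c∈fz)

    total′ : ∀ u → redistribute u ≢ ⊥ → ∃ λ z → redistribute z ≢ ⊥ × (Arc z u ⊎ Arc u z)
    total′ u gu≢⊥ with u ≟V v | emptySuccessor? u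
    ... | yes refl | _ with total v fv≢⊥
    ...   | z , fz≢⊥ , arc = z , redistribute-nonempty fz≢⊥ , arc
    total′ u gu≢⊥ | no _ | yes (v→u , _) = v , redistribute-nonempty fv≢⊥ , inj₁ v→u
    total′ u gu≢⊥ | no _ | no  _ with total u gu≢⊥
    ...   | z , fz≢⊥ , arc = z , redistribute-nonempty fz≢⊥ , arc

  private
    successorIndicator : V m n → ℕ
    successorIndicator u = if isYes (emptySuccessor? u) then 1 else 0

  redistribute-weight : wt redistribute + ∣ f v ∣ ≡ wt f + 1 + #emptySuccessors
  redistribute-weight = begin
    wt redistribute + ∣ f v ∣
      ≡⟨ cong (wt redistribute +_) (sym (gridSum-pointMass v ∣ f v ∣)) ⟩
    wt redistribute + gridSum (pointMass v ∣ f v ∣)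
      ≡⟨ sym (gridSum-distrib-+ (∣_∣ ∘ redistribute) (pointMass v ∣ f v ∣)) ⟩
    gridSum (λ u → ∣ redistribute u ∣ + pointMass v ∣ f v ∣ u)
      ≡⟨ gridSum-cong pointwise ⟩
    gridSum (λ u → ∣ f u ∣ + pointMass v 1 u + successorIndicator u)
      ≡⟨ gridSum-distrib-+ (λ u → ∣ f u ∣ + pointMass v 1 u) successorIndicator ⟩
    gridSum (λ u → ∣ f u ∣ + pointMass v 1 u) + #emptySuccessors
      ≡⟨ cong (_+ #emptySuccessors) (gridSum-distrib-+ (∣_∣ ∘ f) (pointMass v 1)) ⟩
    wt f + gridSum (pointMass v 1) + #emptySuccessors
      ≡⟨ cong (λ a → wt f + a + #emptySuccessors) (gridSum-pointMass v 1) ⟩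
    wt f + 1 + #emptySuccessors ∎
    where
    open ≡-Reasoning
    pointwise : ∀ u → ∣ redistribute u ∣ + pointMass v ∣ f v ∣ u
                      ≡ ∣ f u ∣ + pointMass v 1 u + successorIndicator u
    pointwise u with u ≟V v | emptySuccessor? u
    ... | yes refl | yes (v→v , _) = contradiction v→v Arc-irrefl
    ... | yes refl | no  _ =
      trans (cong (_+ ∣ f v ∣) (∣⁅x⁆∣≡1 c₀)) (trans (+-comm 1 ∣ f v ∣) (sym (+-identityʳ _)))
    ... | no  _    | yes (_ , fu≡⊥) = begin
      ∣ ⁅ c₀ ⁆ ∣ + 0    ≡⟨ cong (_+ 0) (∣⁅x⁆∣≡1 c₀) ⟩
      1                 ≡⟨ cong (λ a → a + 0 + 1) (sym (trans (cong ∣_∣ fu≡⊥) (∣⊥∣≡0 (suc k)))) ⟩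
      ∣ f u ∣ + 0 + 1   ∎
    ... | no  _    | no  _ = sym (+-identityʳ _)

  redistribute-numEmpty : f v ≢ ⊥ → #∅ redistribute + #emptySuccessors ≡ #∅ f
  redistribute-numEmpty fv≢⊥ =
    trans (sym (gridSum-distrib-+ (emptyIndicator ∘ redistribute) successorIndicator))
          (gridSum-cong pointwise)
    where
    pointwise : ∀ u → emptyIndicator (redistribute u) + successorIndicator u ≡ emptyIndicator (f u)
    pointwise u with u ≟V v | emptySuccessor? u
    ... | yes refl | yes (v→v , _) = contradiction v→v Arc-irrefl
    ... | yes refl | no  _ =
      trans (+-identityʳ _) (trans (emptyIndicator-≢⊥ (⁅x⁆≢⊥ c₀)) (sym (emptyIndicator-≢⊥ fv≢⊥)))
    ... | no  _    | yes (_ , fu≡⊥) =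
      trans (cong (_+ 1) (emptyIndicator-≢⊥ (⁅x⁆≢⊥ c₀)))
            (trans (sym emptyIndicator-⊥) (cong emptyIndicator (sym fu≡⊥)))
    ... | no  _    | no  _ = +-identityʳ _

module Minimal {k m n : ℕ} (f : Labeling (suc k) m n)
               (γ : IsGammaTRKFunction (suc k) m n f)
               (fewestEmpty : ∀ g → IsGammaTRKFunction (suc k) m n g → #∅ f ≤ #∅ g) where

  open Redistribution f

  rdf : IsKRDF (suc k) m n f
  rdf = proj₁ (proj₁ γ)

  surplus≤1+#emptySuccessors : ∀ v → f v ≢ ⊥ → ∣ f v ∣ ≤ 1 + #emptySuccessors v
  surplus≤1+#emptySuccessors v fv≢⊥ = +-cancelˡ-≤ (wt f) _ _ (begin
    wt f + ∣ f v ∣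
      ≤⟨ +-monoˡ-≤ ∣ f v ∣ (proj₂ γ _ (redistribute-isTKRDF v (proj₁ γ) fv≢⊥)) ⟩
    wt (redistribute v) + ∣ f v ∣      ≡⟨ redistribute-weight v ⟩
    wt f + 1 + #emptySuccessors v      ≡⟨ +-assoc (wt f) 1 (#emptySuccessors v) ⟩
    wt f + (1 + #emptySuccessors v)    ∎)
    where open ≤-Reasoning

  -- When the bound is attained the redistribution is again a minimum-weight function.
  tight⇒#emptySuccessors≡0 : ∀ v → f v ≢ ⊥ → ∣ f v ∣ ≡ 1 + #emptySuccessors v →
                             #emptySuccessors v ≡ 0
  tight⇒#emptySuccessors≡0 v fv≢⊥ tight =
    n≤0⇒n≡0 (+-cancelˡ-≤ (#∅ g) _ _ (begin
      #∅ g + #emptySuccessors v  ≡⟨ redistribute-numEmpty v fv≢⊥ ⟩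
      #∅ f                       ≤⟨ fewestEmpty g (tkg , g-minimum) ⟩
      #∅ g                       ≡⟨ +-identityʳ (#∅ g) ⟨
      #∅ g + 0                   ∎))
    where
    open ≤-Reasoning
    g : Labeling (suc k) m n
    g = redistribute v
    tkg : IsTKRDF (suc k) m n g
    tkg = redistribute-isTKRDF v (proj₁ γ) fv≢⊥
    wt-f≡wt-g : wt f ≡ wt g
    wt-f≡wt-g = +-cancelʳ-≡ ∣ f v ∣ (wt f) (wt g) (sym (trans (redistribute-weight v)
                  (trans (+-assoc (wt f) 1 _) (cong (wt f +_) (sym tight)))))
    g-minimum : ∀ h → IsTKRDF (suc k) m n h → wt g ≤ wt h
    g-minimum h tkh = subst (_≤ wt h) wt-f≡wt-g (proj₂ γ h tkh)

  surplus≤#emptySuccessors : ∀ v → 2 ≤ ∣ f v ∣ → ∣ f v ∣ ≤ #emptySuccessors v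
  surplus≤#emptySuccessors v 2≤∣fv∣ with ∣ f v ∣ ≤? #emptySuccessors v
  ... | yes ∣fv∣≤# = ∣fv∣≤#
  ... | no  ∣fv∣≰# = contradiction (subst (2 ≤_) ∣fv∣≡1 2≤∣fv∣) λ { (s≤s ()) }
    where
    fv≢⊥ : f v ≢ ⊥
    fv≢⊥ = 1≤∣p∣⇒p≢⊥ (≤-trans (s≤s z≤n) 2≤∣fv∣)
    tight : ∣ f v ∣ ≡ 1 + #emptySuccessors v
    tight = ≤-antisym (surplus≤1+#emptySuccessors v fv≢⊥) (≰⇒> ∣fv∣≰#)
    ∣fv∣≡1 : ∣ f v ∣ ≡ 1
    ∣fv∣≡1 = trans tight (cong suc (tight⇒#emptySuccessors≡0 v fv≢⊥ tight))

  module _ (2≤k : 2 ≤ k) where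

    1<1+k : 1 < suc k
    1<1+k = s≤s (≤-trans (s≤s z≤n) 2≤k)

    ∣f∣≤1-of-out-neighbours : ∀ v d r → (∀ w → Arc v w → w ≡ d ⊎ w ≡ r) →
                              (Arc v r → ∀ z → Arc z r → z ≡ v) → ∣ f v ∣ ≤ 1
    ∣f∣≤1-of-out-neighbours v d r out r-private with ∣ f v ∣ ≤? 1
    ... | yes ∣fv∣≤1 = ∣fv∣≤1
    ... | no  ∣fv∣≰1 = contradiction (surplus≤#emptySuccessors v 2≤∣fv∣) (<⇒≱ #<∣fv∣)
      where
      2≤∣fv∣ : 2 ≤ ∣ f v ∣
      2≤∣fv∣ = ≰⇒> ∣fv∣≰1
      #<∣fv∣ : #emptySuccessors v < ∣ f v ∣
      #<∣fv∣ with emptySuccessor? v r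
      ... | yes (v→r , fr≡⊥) = begin-strict
        #emptySuccessors v  ≤⟨ count≤length (emptySuccessor? v) (d ∷ r ∷ [])
                                 (λ w (v→w , _) → [ here , there ∘ here ]′ (out w v→w)) ⟩
        2                   <⟨ s≤s 2≤k ⟩
        suc k               ≡⟨ sole-in-neighbour-saturated rdf fr≡⊥ (r-private v→r) ⟨
        ∣ f v ∣             ∎
        where open ≤-Reasoning
      ... | no ¬Er = <-≤-trans (s≤s (count≤length (emptySuccessor? v) (d ∷ []) only-d)) 2≤∣fv∣
        where
        only-d : ∀ w → EmptySuccessor v w → w ∈ₗ d ∷ []
        only-d w (v→w , fw≡⊥) with out w v→w
        ... | inj₁ w≡d = here w≡d
        ... | inj₂ refl = contradiction (v→w , fw≡⊥) ¬Er

    firstRowOrColumn-≤1 : ∀ i j → OnFirstRowOrColumn (i , j) → ∣ f (i , j) ∣ ≤ 1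
    firstRowOrColumn-≤1 zero    j       (inj₁ _) =
      ∣f∣≤1-of-out-neighbours _ _ _ (λ _ → out-neighbour-next) row₀-in-neighbour-unique
    firstRowOrColumn-≤1 i       zero    (inj₂ _) =
      ∣f∣≤1-of-out-neighbours _ _ _ (λ _ → swap ∘ out-neighbour-next) column₀-in-neighbour-unique
    firstRowOrColumn-≤1 (suc i) (suc j) (inj₁ ())
    firstRowOrColumn-≤1 (suc i) (suc j) (inj₂ ())

    firstRowOrColumn-nonempty : ∀ i j → OnFirstRowOrColumn (i , j) → f (i , j) ≢ ⊥
    firstRowOrColumn-nonempty zero    zero    _ = source-nonempty rdf ¬Arc-into-origin
    firstRowOrColumn-nonempty zero    (suc j) _ =
      unsaturated-sole-in-neighbour⇒nonempty rdf
        (≤-<-trans (firstRowOrColumn-≤1 zero (inject₁ j) (inj₁ refl)) 1<1+k)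
        (row₀-in-neighbour-unique (inj₂ (refl , PArc-inject₁ j)))
    firstRowOrColumn-nonempty (suc i) zero    _ =
      unsaturated-sole-in-neighbour⇒nonempty rdf
        (≤-<-trans (firstRowOrColumn-≤1 (inject₁ i) zero (inj₂ refl)) 1<1+k)
        (column₀-in-neighbour-unique (inj₁ (PArc-inject₁ i , refl)))
    firstRowOrColumn-nonempty (suc i) (suc j) (inj₁ ())
    firstRowOrColumn-nonempty (suc i) (suc j) (inj₂ ())

    firstRowOrColumn-singleton : ∀ i j → OnFirstRowOrColumn (i , j) → ∣ f (i , j) ∣ ≡ 1
    firstRowOrColumn-singleton i j first =
      ≤-antisym (firstRowOrColumn-≤1 i j first) (p≢⊥⇒1≤∣p∣ (firstRowOrColumn-nonempty i j first))

lemma4p8 : (n : ℕ) → 3 ≤ n → (f : Labeling 3 3 n) →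
    IsGammaTRKFunction 3 3 n f →
    (∀ (g : Labeling 3 3 n) → IsGammaTRKFunction 3 3 n g →
       numEmpty 3 3 n f ≤ numEmpty 3 3 n g) →
    (∀ (i : Fin 3) (j : Fin n) → toℕ j ≡ 0 → ∣ f (i , j) ∣ ≡ 1) ×
    (∀ (j : Fin n) → 1 ≤ toℕ j → ∣ f (zero , j) ∣ ≡ 1)
lemma4p8 n _ f γ fewestEmpty =
  (λ i j j≡0 → firstRowOrColumn-singleton ≤-refl i j (inj₂ j≡0)) ,
  (λ j _ → firstRowOrColumn-singleton ≤-refl zero j (inj₁ refl))
  where open Minimal f γ fewestEmpty
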